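{- Let $M$ be an odd prime power and $n$ a positive integer. Then $\mathcal D(n,M)\le (M-1)\log_2(n+1)$.
   Context: $\mathcal D(n,M)$ denotes the largest dimension of an affine subspace $C$ of $\mathbb F_2^n$ such that for some $0\le a\le M$ there exists exactly one point $x_0\in C$ whose Hamming weight (number of ones) is $\equiv a\pmod M$. -}

module Defs where

open import Data.Bool using (Bool; true; false; _xor_)
open import Data.Nat using (ℕ; zero; suc; _+_; _^_; _≤_)
open import Data.Nat.Primality using (Prime)
open import Data.Vec using (Vec; []; _∷_; zipWith; replicate; foldr)
open import Data.Integer as ℤ using (ℤ; +_; _-_)
open import Data.Integer.Divisibility using (_∣_)
open import Data.Product using (Σ; ∃; _×_; _,_)
open import Relation.Binary.PropositionalEquality using (_≡_)
open import Relation.Nullary using (¬_)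

𝔽₂^ : ℕ → Set
𝔽₂^ n = Vec Bool n

_⊕_ : ∀ {n} → 𝔽₂^ n → 𝔽₂^ n → 𝔽₂^ n
_⊕_ = zipWith _xor_

𝟎 : ∀ {n} → 𝔽₂^ n
𝟎 = replicate _ false

weight : ∀ {n} → 𝔽₂^ n → ℕ
weight [] = 0
weight (true ∷ x) = suc (weight x)
weight (false ∷ x) = weight x

lincomb : ∀ {n d} → Vec Bool d → Vec (𝔽₂^ n) d → 𝔽₂^ n
lincomb [] [] = 𝟎
lincomb (true ∷ c) (v ∷ vs) = v ⊕ lincomb c vs
lincomb (false ∷ c) (v ∷ vs) = lincomb c vs

LinIndep : ∀ {n d} → Vec (𝔽₂^ n) d → Set
LinIndep {d = d} vs = ∀ (c : Vec Bool d) → lincomb c vs ≡ 𝟎 → c ≡ replicate d false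

record AffineSubspace (n d : ℕ) : Set where
  constructor affine
  field
    base  : 𝔽₂^ n
    dirs  : Vec (𝔽₂^ n) d
    indep : LinIndep dirs

_∈A_ : ∀ {n d} → 𝔽₂^ n → AffineSubspace n d → Set
_∈A_ {d = d} x C = Σ (Vec Bool d) λ c → x ≡ AffineSubspace.base C ⊕ lincomb c (AffineSubspace.dirs C)

_≡_[mod_] : ℕ → ℕ → ℕ → Set
x ≡ y [mod M ] = (+ M) ∣ ((+ x) - (+ y))

UniqueWeightClass : ∀ {n d} → AffineSubspace n d → ℕ → ℕ → Set
UniqueWeightClass C M a =
  Σ _ λ x₀ → (x₀ ∈A C) × (weight x₀ ≡ a [mod M ])
    × (∀ y → y ∈A C → weight y ≡ a [mod M ] → y ≡ x₀)

OddPrimePower : ℕ → Set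
OddPrimePower M = Σ ℕ λ p → Σ ℕ λ k → Prime p × ¬ (p ≡ 2) × 1 ≤ k × M ≡ p ^ k

-- Write M = p ^ k. Since p divides (M choose i) for 0 < i < M, each w ↦ (w choose j) with j < M
-- is M-periodic modulo p, and a triangular solve writes the indicator of w ≡ a (mod M) as a
-- combination of these binomials modulo p. As (weight (x ⊕ t) choose j) is a polynomial of
-- degree j in the bits of x, every δᵢ x = [weight (x ⊕ Pᵢ ⊕ x₀) ≡ a (mod M)] is, modulo p, a
-- combination of the (n + 1) ^ (M − 1) products of M − 1 factors from {1, x₁, …, xₙ}. For the
-- 2 ^ d points Pᵢ of C, the point Pⱼ ⊕ Pᵢ ⊕ x₀ of C is x₀ exactly when i = j, so δᵢ Pⱼ = [i = j]:
-- the δᵢ are linearly independent over 𝔽ₚ, whence 2 ^ d ≤ (n + 1) ^ (M − 1).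

module Submission where

open import Defs
open import Data.Bool using (Bool; true; false; if_then_else_; _xor_)
open import Data.Bool.Properties using (xor-identityˡ; xor-identityʳ; xor-assoc; xor-comm; xor-same)
open import Data.Fin as Fin using (Fin; zero; suc; toℕ; _↑ˡ_; _↑ʳ_; combine; remQuot; punchIn)
open import Data.Fin.Properties
  using ( 2↔Bool; punchInᵢ≢i; remQuot-combine; toℕ-fromℕ<; toℕ<n; toℕ-injective; injective⇒≤
        ; funToFin-finToFin; finToFun-funToFin)
import Data.Integer as ℤ
import Data.Integer.Properties as ℤₚ
import Data.Integer.Divisibility.Signed as ℤ∣
open import Data.Integer.Solver renaming (module +-*-Solver to ℤ-Solver)
open import Data.Nat
open import Data.Nat.Properties
open import Algebra.Properties.Semiring.Sum +-*-semiring
  using ( sum; sum-syntax; sum-cong-≗; sum-replicate-zero; sum-remove; ∑-distrib-+; ∑-comm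
        ; *-distribˡ-sum; *-distribʳ-sum)
open import Data.Nat.DivMod
open import Data.Nat.Divisibility
  using (_∣_; _∣?_; divides; ∣⇒≤; n∣m⇒m%n≡0; 1∣_; ∣-trans; m∣m*n; *-monoʳ-∣; *-cancelˡ-∣)
open import Data.Nat.Combinatorics using (k>n⇒nCk≡0; nC1≡n; nCn≡1; nCk+nC[k+1]≡[n+1]C[k+1]) renaming (_C_ to _choose_)
open import Data.Nat.Primality using (Prime; euclidsLemma; prime⇒nonZero; prime⇒nonTrivial)
open import Data.Nat.Solver using (module +-*-Solver)
open import Data.Product using (∃-syntax; _×_; _,_; proj₁; proj₂)
open import Data.Sum using (inj₁; inj₂)
open import Data.Vec using (Vec; []; _∷_; lookup; tabulate)
open import Data.Vec.Properties using (lookup-zipWith; lookup∘tabulate; zipWith-assoc; zipWith-comm; zipWith-identityˡ)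
open import Function using (_∘_; Inverse; Injection)
open import Function.Properties.Inverse using (↔⇒↣)
open import Relation.Binary.PropositionalEquality
open import Relation.Nullary using (¬_; Dec; yes; no; does; contradiction)
open import Relation.Nullary.Decidable using (dec-true; dec-false)

∑-++ : ∀ a {b} (f : Fin (a + b) → ℕ) → sum f ≡ ∑[ i < a ] f (i ↑ˡ b) + ∑[ j < b ] f (a ↑ʳ j)
∑-++ zero    f = refl
∑-++ (suc a) f = trans (cong (f zero +_) (∑-++ a (f ∘ suc))) (sym (+-assoc (f zero) _ _))

∑-combine : ∀ a b (f : Fin (a * b) → ℕ) → sum f ≡ ∑[ q < a ] ∑[ r < b ] f (combine q r)
∑-combine zero    b f = refl
∑-combine (suc a) b f = trans (∑-++ b f) (cong (∑[ r < b ] f (r ↑ˡ a * b) +_) (∑-combine a b (f ∘ (b ↑ʳ_))))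

∑-single : ∀ {m} (k : Fin m) (f : Fin m → ℕ) → (∀ i → i ≢ k → f i ≡ 0) → sum f ≡ f k
∑-single {suc m} k f vanishes = begin
  sum f                               ≡⟨ sum-remove {i = k} f ⟩
  f k + ∑[ i < m ] f (punchIn k i)    ≡⟨ cong (f k +_) (sum-cong-≗ (λ i → vanishes _ (punchInᵢ≢i k i))) ⟩
  f k + ∑[ i < m ] 0                  ≡⟨ cong (f k +_) (sum-replicate-zero m) ⟩
  f k + 0                             ≡⟨ +-identityʳ (f k) ⟩
  f k                                 ∎
  where open ≡-Reasoning

module Modulo (p : ℕ) .{{_ : NonZero p}} where

  infix 4 _≈_
  _≈_ : ℕ → ℕ → Set
  x ≈ y = x % p ≡ y % p

  ≈-+ : ∀ {x x′ y y′} → x ≈ x′ → y ≈ y′ → x + y ≈ x′ + y′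
  ≈-+ {x} {x′} {y} {y′} x≈x′ y≈y′ = begin
    (x + y) % p                 ≡⟨ %-distribˡ-+ x y p ⟩
    (x % p + y % p) % p         ≡⟨ cong₂ (λ u v → (u + v) % p) x≈x′ y≈y′ ⟩
    (x′ % p + y′ % p) % p       ≡⟨ %-distribˡ-+ x′ y′ p ⟨
    (x′ + y′) % p               ∎
    where open ≡-Reasoning

  ≈-* : ∀ {x x′ y y′} → x ≈ x′ → y ≈ y′ → x * y ≈ x′ * y′
  ≈-* {x} {x′} {y} {y′} x≈x′ y≈y′ = begin
    (x * y) % p                 ≡⟨ %-distribˡ-* x y p ⟩
    (x % p * (y % p)) % p       ≡⟨ cong₂ (λ u v → (u * v) % p) x≈x′ y≈y′ ⟩
    (x′ % p * (y′ % p)) % p     ≡⟨ %-distribˡ-* x′ y′ p ⟨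
    (x′ * y′) % p               ∎
    where open ≡-Reasoning

  ≈-sum : ∀ {m} {f g : Fin m → ℕ} → (∀ i → f i ≈ g i) → sum f ≈ sum g
  ≈-sum {zero}  f≈g = refl
  ≈-sum {suc m} f≈g = ≈-+ (f≈g zero) (≈-sum (f≈g ∘ suc))

  %-≈ : ∀ x → x % p ≈ x
  %-≈ x = m%n%n≡m%n x p

  +*p-≈ : ∀ x k → x + k * p ≈ x
  +*p-≈ x k = [m+kn]%n≡m%n x k p

-- Binomial coefficients

[1+k]*[1+n]C[1+k]≡[1+n]*nCk : ∀ n k → suc k * (suc n choose suc k) ≡ suc n * (n choose k)
[1+k]*[1+n]C[1+k]≡[1+n]*nCk n       zero    = trans (+-identityʳ _) (trans (nC1≡n (suc n)) (sym (*-identityʳ (suc n))))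
[1+k]*[1+n]C[1+k]≡[1+n]*nCk zero    (suc k) = trans (cong (suc (suc k) *_) (k>n⇒nCk≡0 (s<s (z<s {k})))) (*-zeroʳ (suc (suc k)))
[1+k]*[1+n]C[1+k]≡[1+n]*nCk (suc n) (suc k) = begin
  suc (suc k) * (suc (suc n) choose suc (suc k))
    ≡⟨ cong (suc (suc k) *_) (nCk+nC[k+1]≡[n+1]C[k+1] (suc n) (suc k)) ⟨
  suc (suc k) * (X + Y)
    ≡⟨ solve 3 (λ k x y → (con 2 :+ k) :* (x :+ y) := ((con 1 :+ k) :* x :+ x) :+ (con 2 :+ k) :* y) refl k X Y ⟩
  (suc k * X + X) + suc (suc k) * Y
    ≡⟨ cong₂ (λ u v → (u + X) + v) ([1+k]*[1+n]C[1+k]≡[1+n]*nCk n k) ([1+k]*[1+n]C[1+k]≡[1+n]*nCk n (suc k)) ⟩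
  (suc n * (n choose k) + X) + suc n * (n choose suc k)
    ≡⟨ solve 4 (λ n a x b → ((con 1 :+ n) :* a :+ x) :+ (con 1 :+ n) :* b := x :+ (con 1 :+ n) :* (a :+ b))
               refl n (n choose k) X (n choose suc k) ⟩
  X + suc n * (n choose k + n choose suc k)
    ≡⟨ cong (λ z → X + suc n * z) (nCk+nC[k+1]≡[n+1]C[k+1] n k) ⟩
  suc (suc n) * X
    ∎
  where
  open ≡-Reasoning
  open +-*-Solver
  X = suc n choose suc k
  Y = suc n choose suc (suc k)

n∣[1+k]*nC[1+k] : ∀ n k → n ∣ suc k * (n choose suc k)
n∣[1+k]*nC[1+k] zero    k = divides 0 (trans (cong (suc k *_) (k>n⇒nCk≡0 (z<s {k}))) (*-zeroʳ (suc k)))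
n∣[1+k]*nC[1+k] (suc n) k = divides (n choose k) (trans ([1+k]*[1+n]C[1+k]≡[1+n]*nCk n k) (*-comm (suc n) _))

module _ {p : ℕ} (p-prime : Prime p) where

  p^k∣m*n∧p∤n⇒p^k∣m : ∀ k {m n} → p ^ k ∣ m * n → ¬ p ∣ n → p ^ k ∣ m
  p^k∣m*n∧p∤n⇒p^k∣m zero    _ _ = 1∣ _
  p^k∣m*n∧p∤n⇒p^k∣m (suc k) {m} {n} p^[1+k]∣mn p∤n with euclidsLemma m n p-prime (∣-trans (m∣m*n (p ^ k)) p^[1+k]∣mn)
  ... | inj₂ p∣n              = contradiction p∣n p∤n
  ... | inj₁ (divides q refl) =
    subst (p * p ^ k ∣_) (*-comm p q) (*-monoʳ-∣ p (p^k∣m*n∧p∤n⇒p^k∣m k (*-cancelˡ-∣ p p*p^k∣p*qn) p∤n))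
    where
    instance _ = prime⇒nonZero p-prime
    open +-*-Solver
    p*p^k∣p*qn : p * p ^ k ∣ p * (q * n)
    p*p^k∣p*qn = subst (p * p ^ k ∣_) (solve 3 (λ q p n → (q :* p) :* n := p :* (q :* n)) refl q p n) p^[1+k]∣mn

  p∣[p^k]C[1+i] : ∀ k i → suc i < p ^ k → p ∣ p ^ k choose suc i
  p∣[p^k]C[1+i] k i i<p^k with p ∣? p ^ k choose suc i
  ... | yes p∣ = p∣
  ... | no  p∤ = contradiction (∣⇒≤ (p^k∣m*n∧p∤n⇒p^k∣m k (n∣[1+k]*nC[1+k] (p ^ k) i) p∤)) (<⇒≱ i<p^k)

-- Binomial expansions of periodic functions modulo p

binomialSum : (ℕ → ℕ) → ℕ → ℕ → ℕ
binomialSum c zero    w = 0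
binomialSum c (suc K) w = binomialSum c K w + c K * (w choose K)

binomialSum-cong : ∀ {c c′} K → (∀ j → j < K → c j ≡ c′ j) → ∀ w → binomialSum c K w ≡ binomialSum c′ K w
binomialSum-cong zero    c≡c′ w = refl
binomialSum-cong (suc K) c≡c′ w =
  cong₂ _+_ (binomialSum-cong K (λ j j<K → c≡c′ j (m<n⇒m<1+n j<K)) w) (cong (_* (w choose K)) (c≡c′ K ≤-refl))

module Interpolation (p : ℕ) .{{_ : NonZero p}} where
  open Modulo p

  -- Triangular solve: w choose K vanishes for w < K and is 1 at w = K.
  interpolate : (f : ℕ → ℕ) → ∀ K → ∃[ c ] ∀ w → w < K → binomialSum c K w ≈ f w
  interpolate f zero    = (λ _ → 0) , λ _ ()
  interpolate f (suc K) = c′ , interpolates′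
    where
    c = proj₁ (interpolate f K)
    interpolates = proj₂ (interpolate f K)
    S = binomialSum c K K

    c′ : ℕ → ℕ
    c′ j = if does (j ≟ K) then f K + pred p * S else c j

    c′≡c : ∀ j → j < K → c′ j ≡ c j
    c′≡c j j<K rewrite dec-false (j ≟ K) (<⇒≢ j<K) = refl

    c′K : c′ K ≡ f K + pred p * S
    c′K rewrite dec-true (K ≟ K) refl = refl

    interpolates′ : ∀ w → w < suc K → binomialSum c′ (suc K) w ≈ f w
    interpolates′ w w≤K with m≤n⇒m<n∨m≡n (s≤s⁻¹ w≤K)
    ... | inj₁ w<K = begin
      (binomialSum c′ K w + c′ K * (w choose K)) % p
        ≡⟨ cong (λ t → (binomialSum c′ K w + c′ K * t) % p) (k>n⇒nCk≡0 w<K) ⟩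
      (binomialSum c′ K w + c′ K * 0) % p
        ≡⟨ cong (_% p) (trans (cong (binomialSum c′ K w +_) (*-zeroʳ (c′ K))) (+-identityʳ _)) ⟩
      binomialSum c′ K w % p
        ≡⟨ cong (_% p) (binomialSum-cong K c′≡c w) ⟩
      binomialSum c K w % p
        ≡⟨ interpolates w w<K ⟩
      f w % p
        ∎
      where open ≡-Reasoning
    ... | inj₂ refl = begin
      (binomialSum c′ K K + c′ K * (K choose K)) % p
        ≡⟨ cong₂ (λ t u → (t + u * (K choose K)) % p) (binomialSum-cong K c′≡c K) c′K ⟩
      (S + (f K + pred p * S) * (K choose K)) % p
        ≡⟨ cong (λ t → (S + (f K + pred p * S) * t) % p) (nCn≡1 K) ⟩
      (S + (f K + pred p * S) * 1) % p
        ≡⟨ cong (_% p) (solve 3 (λ s f q → s :+ (f :+ q :* s) :* con 1 := f :+ s :* (con 1 :+ q)) refl S (f K) (pred p)) ⟩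
      (f K + S * suc (pred p)) % p
        ≡⟨ cong (λ t → (f K + S * t) % p) (suc-pred p) ⟩
      (f K + S * p) % p
        ≡⟨ +*p-≈ (f K) S ⟩
      f K % p
        ∎
      where
      open ≡-Reasoning
      open +-*-Solver

module PeriodicInterpolation (p M : ℕ) .{{_ : NonZero p}} .{{_ : NonZero M}}
                             (p∣MC[1+i] : ∀ i → suc i < M → p ∣ M choose suc i) where
  open Modulo p

  [w+M]Cj≈wCj : ∀ w j → j < M → (w + M) choose j ≈ w choose j
  [w+M]Cj≈wCj zero    zero    _   = refl
  [w+M]Cj≈wCj zero    (suc j) j<M =
    trans (n∣m⇒m%n≡0 _ p (p∣MC[1+i] j j<M)) (sym (trans (cong (_% p) (k>n⇒nCk≡0 (z<s {j}))) (m*n%n≡0 0 p)))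
  [w+M]Cj≈wCj (suc w) zero    _   = refl
  [w+M]Cj≈wCj (suc w) (suc j) j<M = begin
    (suc (w + M) choose suc j) % p
      ≡⟨ cong (_% p) (nCk+nC[k+1]≡[n+1]C[k+1] (w + M) j) ⟨
    ((w + M) choose j + (w + M) choose suc j) % p
      ≡⟨ ≈-+ ([w+M]Cj≈wCj w j (<-trans (n<1+n j) j<M)) ([w+M]Cj≈wCj w (suc j) j<M) ⟩
    (w choose j + w choose suc j) % p
      ≡⟨ cong (_% p) (nCk+nC[k+1]≡[n+1]C[k+1] w j) ⟩
    (suc w choose suc j) % p
      ∎
    where open ≡-Reasoning

  binomialSum-+M : ∀ c K → K ≤ M → ∀ w → binomialSum c K (w + M) ≈ binomialSum c K w
  binomialSum-+M c zero    _   w = refl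
  binomialSum-+M c (suc K) K<M w = ≈-+ (binomialSum-+M c K (<⇒≤ K<M) w) (≈-* {c K} refl ([w+M]Cj≈wCj w K K<M))

  periodic⇒≈% : (g : ℕ → ℕ) → (∀ w → g (w + M) ≈ g w) → ∀ w → g w ≈ g (w % M)
  periodic⇒≈% g g-periodic w = subst (λ v → g v ≈ g (w % M)) (sym (m≡m%n+[m/n]*n w M)) (shift (w / M))
    where
    shift : ∀ q → g (w % M + q * M) ≈ g (w % M)
    shift zero    = cong (λ v → g v % p) (+-identityʳ (w % M))
    shift (suc q) = trans (cong (λ v → g v % p) (trans (cong (w % M +_) (+-comm M (q * M))) (sym (+-assoc (w % M) (q * M) M))))
                          (trans (g-periodic (w % M + q * M)) (shift q))

  periodic-interpolation : (f : ℕ → ℕ) → (∀ w → f (w + M) ≡ f w) → ∃[ c ] ∀ w → binomialSum c M w ≈ f w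
  periodic-interpolation f f-periodic = c , λ w → begin
    binomialSum c M w % p         ≡⟨ periodic⇒≈% (binomialSum c M) (binomialSum-+M c M ≤-refl) w ⟩
    binomialSum c M (w % M) % p   ≡⟨ interpolates (w % M) (m%n<n w M) ⟩
    f (w % M) % p                 ≡⟨ periodic⇒≈% f (cong (_% p) ∘ f-periodic) w ⟨
    f w % p                       ∎
    where
    open ≡-Reasoning
    open Interpolation p
    c = proj₁ (interpolate f M)
    interpolates = proj₂ (interpolate f M)

-- Counting functions into Fin p

funToFin-cong : ∀ {m n} {f g : Fin m → Fin n} → f ≗ g → Fin.funToFin f ≡ Fin.funToFin g
funToFin-cong {zero}      _   = refl
funToFin-cong {suc m} {n} f≗g = cong₂ (combine {n} {n ^ m}) (f≗g zero) (funToFin-cong (f≗g ∘ suc))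

finToFun-injective : ∀ {m n} {k k′ : Fin (m ^ n)} → Fin.finToFun k ≗ Fin.finToFun k′ → k ≡ k′
finToFun-injective {m} {n} {k} {k′} k≗k′ =
  trans (sym (funToFin-finToFin {n} {m} k)) (trans (funToFin-cong {n} {m} k≗k′) (funToFin-finToFin {n} {m} k′))

injection⇒^≤ : ∀ {m N p} (f : (Fin m → Fin p) → (Fin N → Fin p)) → (∀ {v w} → f v ≗ f w → v ≗ w) → p ^ m ≤ p ^ N
injection⇒^≤ f f-injective = injective⇒≤ {f = Fin.funToFin ∘ f ∘ Fin.finToFun} λ {u} {u′} eq →
  finToFun-injective (f-injective λ r → begin
    f (Fin.finToFun u) r                                ≡⟨ finToFun-funToFin (f (Fin.finToFun u)) r ⟨
    Fin.finToFun (Fin.funToFin (f (Fin.finToFun u))) r  ≡⟨ cong (λ z → Fin.finToFun z r) eq ⟩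
    Fin.finToFun (Fin.funToFin (f (Fin.finToFun u′))) r ≡⟨ finToFun-funToFin (f (Fin.finToFun u′)) r ⟩
    f (Fin.finToFun u′) r                               ∎)
  where open ≡-Reasoning

-- Spans modulo p

module Span (p : ℕ) .{{_ : NonZero p}} {X : Set} where
  open Modulo p

  infix 4 _∈Span_
  record _∈Span_ {N} (f : X → ℕ) (g : Fin N → X → ℕ) : Set where
    constructor span
    field
      coeff  : Fin N → ℕ
      expand : ∀ x → f x ≈ ∑[ r < N ] (coeff r * g r x)
  open _∈Span_

  module _ {N} {g : Fin N → X → ℕ} where

    ∈Span-resp-≈ : ∀ {f f′} → (∀ x → f x ≈ f′ x) → f ∈Span g → f′ ∈Span g
    ∈Span-resp-≈ f≈f′ (span c f≈) = span c λ x → trans (sym (f≈f′ x)) (f≈ x)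

    0∈Span : (λ _ → 0) ∈Span g
    0∈Span = span (λ _ → 0) λ x → cong (_% p) (sym (sum-replicate-zero N))

    +-∈Span : ∀ {f f′} → f ∈Span g → f′ ∈Span g → (λ x → f x + f′ x) ∈Span g
    +-∈Span (span c f≈) (span c′ f′≈) = span (λ r → c r + c′ r) λ x →
      trans (≈-+ (f≈ x) (f′≈ x)) (cong (_% p) (begin
        ∑[ r < N ] (c r * g r x) + ∑[ r < N ] (c′ r * g r x)
          ≡⟨ ∑-distrib-+ (λ r → c r * g r x) (λ r → c′ r * g r x) ⟨
        ∑[ r < N ] (c r * g r x + c′ r * g r x)
          ≡⟨ sum-cong-≗ (λ r → *-distribʳ-+ (g r x) (c r) (c′ r)) ⟨
        ∑[ r < N ] ((c r + c′ r) * g r x)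
          ∎))
      where open ≡-Reasoning

    *-∈Span : ∀ {f} k → f ∈Span g → (λ x → k * f x) ∈Span g
    *-∈Span k (span c f≈) = span (λ r → k * c r) λ x →
      trans (≈-* {k} refl (f≈ x))
            (cong (_% p) (trans (*-distribˡ-sum k (λ r → c r * g r x)) (sum-cong-≗ (λ r → sym (*-assoc k (c r) (g r x))))))

    binomialSum-∈Span : ∀ (W : X → ℕ) c K → (∀ j → j < K → (λ x → W x choose j) ∈Span g) →
                        (λ x → binomialSum c K (W x)) ∈Span g
    binomialSum-∈Span W c zero    _        = 0∈Span
    binomialSum-∈Span W c (suc K) WCj∈Span =
      +-∈Span (binomialSum-∈Span W c K (λ j j<K → WCj∈Span j (m<n⇒m<1+n j<K))) (*-∈Span (c K) (WCj∈Span K ≤-refl))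

  infixr 7 _⊗_
  _⊗_ : ∀ {a b} → (Fin a → X → ℕ) → (Fin b → X → ℕ) → Fin (a * b) → X → ℕ
  (_⊗_ {a} {b} h g) m x = h (Fin.quotient b m) x * g (Fin.remainder {a} b m) x

  ⊗-∈Span : ∀ {a b} {h : Fin a → X → ℕ} {g : Fin b → X → ℕ} {f} i →
            f ∈Span g → (λ x → h i x * f x) ∈Span (h ⊗ g)
  ⊗-∈Span {a} {b} {h} {g} i (span c f≈) = span (λ m → select (remQuot {a} b m)) λ x →
    trans (≈-* {h i x} refl (f≈ x)) (cong (_% p) (sym (expand-⊗ x)))
    where
    select : Fin a × Fin b → ℕ
    select (q , r) = if does (q Fin.≟ i) then c r else 0

    term : X → Fin a × Fin b → ℕ
    term x (q , r) = select (q , r) * (h q x * g r x)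

    off-block : ∀ x q → q ≢ i → ∑[ r < b ] term x (q , r) ≡ 0
    off-block x q q≢i rewrite dec-false (q Fin.≟ i) q≢i = sum-replicate-zero b

    on-block : ∀ x → ∑[ r < b ] term x (i , r) ≡ h i x * ∑[ r < b ] (c r * g r x)
    on-block x rewrite dec-true (i Fin.≟ i) refl =
      trans (sum-cong-≗ (λ r → solve 3 (λ c h g → c :* (h :* g) := h :* (c :* g)) refl (c r) (h i x) (g r x)))
            (sym (*-distribˡ-sum (h i x) (λ r → c r * g r x)))
      where open +-*-Solver

    expand-⊗ : ∀ x → ∑[ m < a * b ] (select (remQuot {a} b m) * (h ⊗ g) m x) ≡ h i x * ∑[ r < b ] (c r * g r x)
    expand-⊗ x = begin
      ∑[ m < a * b ] term x (remQuot {a} b m)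
        ≡⟨ ∑-combine a b (term x ∘ remQuot {a} b) ⟩
      ∑[ q < a ] ∑[ r < b ] term x (remQuot {a} b (combine q r))
        ≡⟨ sum-cong-≗ (λ q → sum-cong-≗ (λ r → cong (term x) (remQuot-combine q r))) ⟩
      ∑[ q < a ] ∑[ r < b ] term x (q , r)
        ≡⟨ ∑-single i _ (off-block x) ⟩
      ∑[ r < b ] term x (i , r)
        ≡⟨ on-block x ⟩
      h i x * ∑[ r < b ] (c r * g r x)
        ∎
      where open ≡-Reasoning

  -- The coefficient vector of Σ vᵢ δᵢ, evaluated at P k, gives back v k; so v ↦ coordinates v
  -- embeds the p ^ m vectors over 𝔽ₚ into the p ^ N coefficient vectors.
  module _ {m N} {g : Fin N → X → ℕ} (δ : Fin m → X → ℕ) (P : Fin m → X) (δ∈Span : ∀ i → δ i ∈Span g)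
           (δ-diag : ∀ i → δ i (P i) ≡ 1) (δ-offdiag : ∀ i k → i ≢ k → δ i (P k) ≡ 0) where

    private
      A : Fin m → Fin N → ℕ
      A i = coeff (δ∈Span i)

      coordinates : (Fin m → Fin p) → Fin N → Fin p
      coordinates v r = Fin.fromℕ< (m%n<n (∑[ i < m ] (toℕ (v i) * A i r)) p)

      evaluate : (Fin N → Fin p) → X → ℕ
      evaluate b x = (∑[ r < N ] (toℕ (b r) * g r x)) % p

      regroup : ∀ (v : Fin m → ℕ) x →
                ∑[ r < N ] (∑[ i < m ] (v i * A i r) * g r x) ≡ ∑[ i < m ] (v i * ∑[ r < N ] (A i r * g r x))
      regroup v x = begin
        ∑[ r < N ] (∑[ i < m ] (v i * A i r) * g r x)  ≡⟨ sum-cong-≗ (λ r → *-distribʳ-sum (g r x) (λ i → v i * A i r)) ⟩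
        ∑[ r < N ] ∑[ i < m ] (v i * A i r * g r x)    ≡⟨ sum-cong-≗ (λ r → sum-cong-≗ (λ i → *-assoc (v i) (A i r) _)) ⟩
        ∑[ r < N ] ∑[ i < m ] (v i * (A i r * g r x))  ≡⟨ ∑-comm (λ r i → v i * (A i r * g r x)) ⟩
        ∑[ i < m ] ∑[ r < N ] (v i * (A i r * g r x))  ≡⟨ sum-cong-≗ (λ i → *-distribˡ-sum (v i) (λ r → A i r * g r x)) ⟨
        ∑[ i < m ] (v i * ∑[ r < N ] (A i r * g r x))  ∎
        where open ≡-Reasoning

      evaluate-coordinates : ∀ v k → evaluate (coordinates v) (P k) ≡ toℕ (v k)
      evaluate-coordinates v k = begin
        (∑[ r < N ] (toℕ (coordinates v r) * g r (P k))) % p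
          ≡⟨ cong (_% p) (sum-cong-≗ (λ r → cong (_* g r (P k)) (toℕ-fromℕ< (m%n<n (vA r) p)))) ⟩
        (∑[ r < N ] (vA r % p * g r (P k))) % p
          ≡⟨ ≈-sum (λ r → ≈-* (%-≈ (vA r)) (refl {x = g r (P k) % p})) ⟩
        (∑[ r < N ] (vA r * g r (P k))) % p
          ≡⟨ cong (_% p) (regroup (toℕ ∘ v) (P k)) ⟩
        (∑[ i < m ] (toℕ (v i) * ∑[ r < N ] (A i r * g r (P k)))) % p
          ≡⟨ ≈-sum (λ i → ≈-* {toℕ (v i)} refl (sym (expand (δ∈Span i) (P k)))) ⟩
        (∑[ i < m ] (toℕ (v i) * δ i (P k))) % p
          ≡⟨ cong (_% p) (∑-single k (λ i → toℕ (v i) * δ i (P k)) vanishes) ⟩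
        (toℕ (v k) * δ k (P k)) % p
          ≡⟨ cong (λ t → (toℕ (v k) * t) % p) (δ-diag k) ⟩
        (toℕ (v k) * 1) % p
          ≡⟨ cong (_% p) (*-identityʳ _) ⟩
        toℕ (v k) % p
          ≡⟨ m<n⇒m%n≡m (toℕ<n (v k)) ⟩
        toℕ (v k)
          ∎
        where
        open ≡-Reasoning
        vA : Fin N → ℕ
        vA r = ∑[ i < m ] (toℕ (v i) * A i r)
        vanishes : ∀ i → i ≢ k → toℕ (v i) * δ i (P k) ≡ 0
        vanishes i i≢k = trans (cong (toℕ (v i) *_) (δ-offdiag i k i≢k)) (*-zeroʳ (toℕ (v i)))

      coordinates-injective : ∀ {v w} → coordinates v ≗ coordinates w → v ≗ w
      coordinates-injective {v} {w} v≗w k = toℕ-injective (begin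
        toℕ (v k)                       ≡⟨ evaluate-coordinates v k ⟨
        evaluate (coordinates v) (P k)  ≡⟨ cong (_% p) (sum-cong-≗ (λ r → cong (λ z → toℕ z * g r (P k)) (v≗w r))) ⟩
        evaluate (coordinates w) (P k)  ≡⟨ evaluate-coordinates w k ⟩
        toℕ (w k)                       ∎)
        where open ≡-Reasoning

    biorthogonal⇒≤ : 1 < p → m ≤ N
    biorthogonal⇒≤ 1<p = ≮⇒≥ λ N<m → <⇒≱ (^-monoʳ-< p 1<p N<m) (injection⇒^≤ coordinates coordinates-injective)

bit : Bool → ℕ
bit false = 0
bit true  = 1

weight≡∑ : ∀ {n} (x : 𝔽₂^ n) → weight x ≡ ∑[ l < n ] bit (lookup x l)
weight≡∑ []          = refl
weight≡∑ (true  ∷ x) = cong suc (weight≡∑ x)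
weight≡∑ (false ∷ x) = weight≡∑ x

weight-⊕ : ∀ {n} (x t : 𝔽₂^ n) → weight (x ⊕ t) ≡ ∑[ l < n ] bit (lookup x l xor lookup t l)
weight-⊕ x t = trans (weight≡∑ (x ⊕ t)) (sum-cong-≗ (λ l → cong bit (lookup-zipWith _xor_ l x t)))

⊕-assoc : ∀ {n} (x y z : 𝔽₂^ n) → (x ⊕ y) ⊕ z ≡ x ⊕ (y ⊕ z)
⊕-assoc = zipWith-assoc xor-assoc

⊕-comm : ∀ {n} (x y : 𝔽₂^ n) → x ⊕ y ≡ y ⊕ x
⊕-comm = zipWith-comm xor-comm

⊕-identityˡ : ∀ {n} (x : 𝔽₂^ n) → 𝟎 ⊕ x ≡ x
⊕-identityˡ = zipWith-identityˡ xor-identityˡ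

⊕-self : ∀ {n} (x : 𝔽₂^ n) → x ⊕ x ≡ 𝟎
⊕-self []      = refl
⊕-self (b ∷ x) = cong₂ _∷_ (xor-same b) (⊕-self x)

⊕-cancelˡ : ∀ {n} (x y : 𝔽₂^ n) → x ⊕ (x ⊕ y) ≡ y
⊕-cancelˡ x y = trans (sym (⊕-assoc x x y)) (trans (cong (_⊕ y) (⊕-self x)) (⊕-identityˡ y))

⊕-cancelʳ-≡ : ∀ {n} {x y} (z : 𝔽₂^ n) → x ⊕ z ≡ y ⊕ z → x ≡ y
⊕-cancelʳ-≡ {x = x} {y} z eq = begin
  x            ≡⟨ ⊕-cancelˡ z x ⟨
  z ⊕ (z ⊕ x)  ≡⟨ cong (z ⊕_) (trans (⊕-comm z x) (trans eq (⊕-comm y z))) ⟩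
  z ⊕ (z ⊕ y)  ≡⟨ ⊕-cancelˡ z y ⟩
  y            ∎
  where open ≡-Reasoning

⊕-leftComm : ∀ {n} (x y z : 𝔽₂^ n) → x ⊕ (y ⊕ z) ≡ y ⊕ (x ⊕ z)
⊕-leftComm x y z = trans (sym (⊕-assoc x y z)) (trans (cong (_⊕ z) (⊕-comm x y)) (⊕-assoc y x z))

⊕-cancel-common : ∀ {n} (v x y : 𝔽₂^ n) → (v ⊕ x) ⊕ (v ⊕ y) ≡ x ⊕ y
⊕-cancel-common v x y = begin
  (v ⊕ x) ⊕ (v ⊕ y)  ≡⟨ ⊕-assoc v x (v ⊕ y) ⟩
  v ⊕ (x ⊕ (v ⊕ y))  ≡⟨ cong (v ⊕_) (⊕-leftComm x v y) ⟩
  v ⊕ (v ⊕ (x ⊕ y))  ≡⟨ ⊕-cancelˡ v (x ⊕ y) ⟩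
  x ⊕ y              ∎
  where open ≡-Reasoning

lincomb-⊕ : ∀ {n d} (c c′ : Vec Bool d) (vs : Vec (𝔽₂^ n) d) → lincomb (c ⊕ c′) vs ≡ lincomb c vs ⊕ lincomb c′ vs
lincomb-⊕ []          []           []       = sym (⊕-self 𝟎)
lincomb-⊕ (true ∷ c)  (true ∷ c′)  (v ∷ vs) = trans (lincomb-⊕ c c′ vs) (sym (⊕-cancel-common v _ _))
lincomb-⊕ (true ∷ c)  (false ∷ c′) (v ∷ vs) = trans (cong (v ⊕_) (lincomb-⊕ c c′ vs)) (sym (⊕-assoc v _ _))
lincomb-⊕ (false ∷ c) (true ∷ c′)  (v ∷ vs) = trans (cong (v ⊕_) (lincomb-⊕ c c′ vs)) (⊕-leftComm v _ _)
lincomb-⊕ (false ∷ c) (false ∷ c′) (v ∷ vs) = lincomb-⊕ c c′ vs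

module _ {n d} (C : AffineSubspace n d) where
  open AffineSubspace C

  point : Vec Bool d → 𝔽₂^ n
  point c = base ⊕ lincomb c dirs

  point-injective : ∀ {c c′} → point c ≡ point c′ → c ≡ c′
  point-injective {c} {c′} eq = ⊕-cancelʳ-≡ c′ (trans (indep (c ⊕ c′) lincomb≡𝟎) (sym (⊕-self c′)))
    where
    open ≡-Reasoning
    same-lincomb : lincomb c dirs ≡ lincomb c′ dirs
    same-lincomb = trans (sym (⊕-cancelˡ base _)) (trans (cong (base ⊕_) eq) (⊕-cancelˡ base _))
    lincomb≡𝟎 : lincomb (c ⊕ c′) dirs ≡ 𝟎
    lincomb≡𝟎 = begin
      lincomb (c ⊕ c′) dirs              ≡⟨ lincomb-⊕ c c′ dirs ⟩
      lincomb c dirs ⊕ lincomb c′ dirs   ≡⟨ cong (_⊕ lincomb c′ dirs) same-lincomb ⟩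
      lincomb c′ dirs ⊕ lincomb c′ dirs  ≡⟨ ⊕-self _ ⟩
      𝟎                                  ∎

  ∈A-⊕₃ : ∀ {x y z} → x ∈A C → y ∈A C → z ∈A C → (x ⊕ (y ⊕ z)) ∈A C
  ∈A-⊕₃ (c , refl) (c′ , refl) (c″ , refl) = c ⊕ (c′ ⊕ c″) , (begin
    point c ⊕ (point c′ ⊕ point c″)
      ≡⟨ cong (point c ⊕_) (⊕-cancel-common base _ _) ⟩
    point c ⊕ (lincomb c′ dirs ⊕ lincomb c″ dirs)
      ≡⟨ ⊕-assoc base _ _ ⟩
    base ⊕ (lincomb c dirs ⊕ (lincomb c′ dirs ⊕ lincomb c″ dirs))
      ≡⟨ cong (λ l → base ⊕ (lincomb c dirs ⊕ l)) (lincomb-⊕ c′ c″ dirs) ⟨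
    base ⊕ (lincomb c dirs ⊕ lincomb (c′ ⊕ c″) dirs)
      ≡⟨ cong (base ⊕_) (lincomb-⊕ c (c′ ⊕ c″) dirs) ⟨
    point (c ⊕ (c′ ⊕ c″))
      ∎)
    where open ≡-Reasoning

enumerate : ∀ {d} → Fin (2 ^ d) → Vec Bool d
enumerate k = tabulate (Inverse.to 2↔Bool ∘ Fin.finToFun k)

enumerate-injective : ∀ {d} {k k′ : Fin (2 ^ d)} → enumerate k ≡ enumerate k′ → k ≡ k′
enumerate-injective {d} {k} {k′} eq = finToFun-injective {2} {d} λ j → Injection.injective (↔⇒↣ 2↔Bool) (begin
  Inverse.to 2↔Bool (Fin.finToFun k j)   ≡⟨ lookup∘tabulate (Inverse.to 2↔Bool ∘ Fin.finToFun k) j ⟨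
  lookup (enumerate {d} k) j             ≡⟨ cong (λ c → lookup c j) eq ⟩
  lookup (enumerate {d} k′) j            ≡⟨ lookup∘tabulate (Inverse.to 2↔Bool ∘ Fin.finToFun k′) j ⟩
  Inverse.to 2↔Bool (Fin.finToFun k′ j)  ∎)
  where open ≡-Reasoning

-- Polynomials on 𝔽₂ⁿ modulo p

[b+w]C[1+j] : ∀ b w j → (bit b + w) choose suc j ≡ w choose suc j + bit b * (w choose j)
[b+w]C[1+j] false w j = sym (+-identityʳ (w choose suc j))
[b+w]C[1+j] true  w j = begin
  suc w choose suc j                 ≡⟨ nCk+nC[k+1]≡[n+1]C[k+1] w j ⟨
  w choose j + w choose suc j        ≡⟨ +-comm (w choose j) (w choose suc j) ⟩
  w choose suc j + w choose j        ≡⟨ cong (w choose suc j +_) (*-identityˡ (w choose j)) ⟨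
  w choose suc j + 1 * (w choose j)  ∎
  where open ≡-Reasoning

module Degree (n p : ℕ) .{{_ : NonZero p}} where
  open Modulo p
  open Span p {𝔽₂^ n}

  -- Literal 0 is the constant 1, so products of exactly D literals span all degrees ≤ D.
  literal : Fin (suc n) → 𝔽₂^ n → ℕ
  literal i x = bit (lookup (true ∷ x) i)

  monomial : ∀ D → Fin (suc n ^ D) → 𝔽₂^ n → ℕ
  monomial zero    _ _ = 1
  monomial (suc D)     = literal ⊗ monomial D

  Degree≤ : ℕ → (𝔽₂^ n → ℕ) → Set
  Degree≤ D f = f ∈Span monomial D

  Degree≤-literal : ∀ i D {f} → Degree≤ D f → Degree≤ (suc D) (λ x → literal i x * f x)
  Degree≤-literal i D = ⊗-∈Span {h = literal} {g = monomial D} i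

  Degree≤-const : ∀ c → Degree≤ 0 (λ _ → c)
  Degree≤-const c = span (λ _ → c) λ x → cong (_% p) (sym (trans (+-identityʳ (c * 1)) (*-identityʳ c)))

  Degree≤-suc : ∀ D {f} → Degree≤ D f → Degree≤ (suc D) f
  Degree≤-suc D {f} deg = ∈Span-resp-≈ (λ x → cong (_% p) (+-identityʳ (f x))) (Degree≤-literal zero D deg)

  Degree≤-mono : ∀ {D D′ f} → D ≤ D′ → Degree≤ D f → Degree≤ D′ f
  Degree≤-mono {D} {f = f} D≤D′ deg = lift (≤⇒≤′ D≤D′)
    where
    lift : ∀ {D′} → D ≤′ D′ → Degree≤ D′ f
    lift ≤′-refl             = deg
    lift (≤′-step {D′} D≤D′) = Degree≤-suc D′ (lift D≤D′)

  Degree≤-xor : ∀ l b D {f} → Degree≤ D f → Degree≤ (suc D) (λ x → bit (lookup x l xor b) * f x)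
  Degree≤-xor l false D {f} deg =
    ∈Span-resp-≈ (λ x → cong (λ y → (bit y * f x) % p) (sym (xor-identityʳ (lookup x l)))) (Degree≤-literal (suc l) D deg)
  Degree≤-xor l true D {f} deg =
    ∈Span-resp-≈ complement (+-∈Span (Degree≤-suc D deg) (*-∈Span (pred p) (Degree≤-literal (suc l) D deg)))
    where
    open +-*-Solver
    -- 1 − xₗ ≡ 1 + (p − 1) xₗ modulo p
    complement : ∀ x → f x + pred p * (bit (lookup x l) * f x) ≈ bit (lookup x l xor true) * f x
    complement x with lookup x l
    ... | true  = begin
      (f x + pred p * (f x + 0)) % p  ≡⟨ cong (_% p) (solve 2 (λ y q → y :+ q :* (y :+ con 0) := con 0 :+ y :* (con 1 :+ q))
                                                             refl (f x) (pred p)) ⟩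
      (0 + f x * suc (pred p)) % p    ≡⟨ cong (λ t → (0 + f x * t) % p) (suc-pred p) ⟩
      (0 + f x * p) % p               ≡⟨ +*p-≈ 0 (f x) ⟩
      0 % p                           ∎
      where open ≡-Reasoning
    ... | false = cong (_% p) (solve 2 (λ y q → y :+ q :* con 0 := y :+ con 0) refl (f x) (pred p))

  Degree≤-binomial-∑ : ∀ {m} (e : Fin m → 𝔽₂^ n → Bool) →
                       (∀ l D {f} → Degree≤ D f → Degree≤ (suc D) (λ x → bit (e l x) * f x)) →
                       ∀ j → Degree≤ j (λ x → (∑[ l < m ] bit (e l x)) choose j)
  Degree≤-binomial-∑         e e-raises zero    = Degree≤-const 1
  Degree≤-binomial-∑ {zero}  e e-raises (suc j) = ∈Span-resp-≈ (λ _ → cong (_% p) (sym (k>n⇒nCk≡0 (z<s {j})))) 0∈Span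
  Degree≤-binomial-∑ {suc m} e e-raises (suc j) =
    ∈Span-resp-≈ (λ x → cong (_% p) (sym ([b+w]C[1+j] (e zero x) _ j))) (+-∈Span (rest (suc j)) (e-raises zero j (rest j)))
    where
    rest : ∀ j → Degree≤ j (λ x → (∑[ l < m ] bit (e (suc l) x)) choose j)
    rest = Degree≤-binomial-∑ (e ∘ suc) (e-raises ∘ suc)

  Degree≤-binomial-weight : ∀ t j → Degree≤ j (λ x → weight (x ⊕ t) choose j)
  Degree≤-binomial-weight t j =
    ∈Span-resp-≈ (λ x → cong (λ w → (w choose j) % p) (sym (weight-⊕ x t)))
                 (Degree≤-binomial-∑ (λ l x → lookup x l xor lookup t l) (λ l → Degree≤-xor l (lookup t l)) j)

-- Indicator of a residue class

_≡?_[mod_] : ∀ w a M → Dec (w ≡ a [mod M ])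
w ≡? a [mod M ] = M ∣? ℤ.∣ ℤ.+ w ℤ.- ℤ.+ a ∣

residueIndicator : ℕ → ℕ → ℕ → ℕ
residueIndicator M a w = bit (does (w ≡? a [mod M ]))

module _ (M w a : ℕ) where

  private
    shift : ℤ.+ (w + M) ℤ.- ℤ.+ a ≡ (ℤ.+ w ℤ.- ℤ.+ a) ℤ.+ ℤ.+ M
    shift = trans (cong (ℤ._- ℤ.+ a) (ℤₚ.pos-+ w M))
                  (solve 3 (λ w m a → (w :+ m) :- a := (w :- a) :+ m) refl (ℤ.+ w) (ℤ.+ M) (ℤ.+ a))
      where open ℤ-Solver

  ≡[mod]-+M : w ≡ a [mod M ] → (w + M) ≡ a [mod M ]
  ≡[mod]-+M h = ℤ∣.∣⇒∣ᵤ (subst (ℤ.+ M ℤ∣.∣_) (sym shift)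
                  (ℤ∣.∣m∣n⇒∣m+n (ℤ∣.∣ᵤ⇒∣ {i = ℤ.+ w ℤ.- ℤ.+ a} h) ℤ∣.∣-refl))

  ≡[mod]-cancel-+M : (w + M) ≡ a [mod M ] → w ≡ a [mod M ]
  ≡[mod]-cancel-+M h = ℤ∣.∣⇒∣ᵤ (ℤ∣.∣m+n∣n⇒∣m {m = ℤ.+ w ℤ.- ℤ.+ a}
                         (subst (ℤ.+ M ℤ∣.∣_) shift (ℤ∣.∣ᵤ⇒∣ h)) ℤ∣.∣-refl)

residueIndicator-+M : ∀ M a w → residueIndicator M a (w + M) ≡ residueIndicator M a w
residueIndicator-+M M a w with w ≡? a [mod M ]
... | yes h = cong bit (dec-true ((w + M) ≡? a [mod M ]) (≡[mod]-+M M w a h))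
... | no ¬h = cong bit (dec-false ((w + M) ≡? a [mod M ]) (¬h ∘ ≡[mod]-cancel-+M M w a))

residueIndicator-≡1 : ∀ M a w → w ≡ a [mod M ] → residueIndicator M a w ≡ 1
residueIndicator-≡1 M a w h = cong bit (dec-true (w ≡? a [mod M ]) h)

residueIndicator-≡0 : ∀ M a w → ¬ w ≡ a [mod M ] → residueIndicator M a w ≡ 0
residueIndicator-≡0 M a w ¬h = cong bit (dec-false (w ≡? a [mod M ]) ¬h)

module UniqueWeightClassBound {n d p a} (p-prime : Prime p) (k : ℕ) (C : AffineSubspace n d) {x₀ : 𝔽₂^ n}
         (x₀∈C : x₀ ∈A C) (x₀≡a : weight x₀ ≡ a [mod p ^ k ])
         (x₀-unique : ∀ y → y ∈A C → weight y ≡ a [mod p ^ k ] → y ≡ x₀) where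

  private
    instance
      p-nonZero : NonZero p
      p-nonZero = prime⇒nonZero p-prime
      p-nonTrivial : NonTrivial p
      p-nonTrivial = prime⇒nonTrivial p-prime
      M-nonZero : NonZero (p ^ k)
      M-nonZero = m^n≢0 p k

  open Modulo p
  open Span p
  open Degree n p

  M : ℕ
  M = p ^ k

  P : Fin (2 ^ d) → 𝔽₂^ n
  P i = point C (enumerate i)

  t : Fin (2 ^ d) → 𝔽₂^ n
  t i = P i ⊕ x₀

  δ : Fin (2 ^ d) → 𝔽₂^ n → ℕ
  δ i x = residueIndicator M a (weight (x ⊕ t i))

  P⊕t≡x₀⇒≡ : ∀ i j → P j ⊕ t i ≡ x₀ → j ≡ i
  P⊕t≡x₀⇒≡ i j eq = enumerate-injective (point-injective C (⊕-cancelʳ-≡ (t i) (trans eq (sym (⊕-cancelˡ (P i) x₀)))))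

  δ-diag : ∀ i → δ i (P i) ≡ 1
  δ-diag i = residueIndicator-≡1 M a _ (subst (λ y → weight y ≡ a [mod M ]) (sym (⊕-cancelˡ (P i) x₀)) x₀≡a)

  δ-offdiag : ∀ i j → i ≢ j → δ i (P j) ≡ 0
  δ-offdiag i j i≢j = residueIndicator-≡0 M a (weight (P j ⊕ t i)) λ h →
    i≢j (sym (P⊕t≡x₀⇒≡ i j (x₀-unique _ (∈A-⊕₃ C (enumerate j , refl) (enumerate i , refl) x₀∈C) h)))

  indicator-expansion : ∃[ c ] ∀ w → binomialSum c M w ≈ residueIndicator M a w
  indicator-expansion = periodic-interpolation (residueIndicator M a) (residueIndicator-+M M a)
    where open PeriodicInterpolation p M (p∣[p^k]C[1+i] p-prime k)

  δ-degree : ∀ i → Degree≤ (M ∸ 1) (δ i)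
  δ-degree i = ∈Span-resp-≈ (λ x → proj₂ indicator-expansion (weight (x ⊕ t i)))
    (binomialSum-∈Span (λ x → weight (x ⊕ t i)) (proj₁ indicator-expansion) M λ j j<M →
      Degree≤-mono (subst (j ≤_) (pred[m∸n]≡m∸[1+n] M 0) (suc[m]≤n⇒m≤pred[n] j<M)) (Degree≤-binomial-weight (t i) j))

  2^d≤[1+n]^[M∸1] : 2 ^ d ≤ suc n ^ (M ∸ 1)
  2^d≤[1+n]^[M∸1] = biorthogonal⇒≤ δ P δ-degree δ-diag δ-offdiag (nonTrivial⇒n>1 p)

corollary4p20 : (M n : ℕ) → OddPrimePower M → 1 ≤ n →
    ∀ (d : ℕ) (C : AffineSubspace n d) (a : ℕ) → a ≤ M →
    UniqueWeightClass C M a →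
    2 ^ d ≤ (suc n) ^ (M ∸ 1)
corollary4p20 M n (p , k , p-prime , _ , _ , refl) _ d C a _ (x₀ , x₀∈C , x₀≡a , x₀-unique) =
  UniqueWeightClassBound.2^d≤[1+n]^[M∸1] {a = a} p-prime k C x₀∈C x₀≡a x₀-unique
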